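{- Let $\sigma\in S_\infty$. Then $\sigma\in S_\infty^f$ if and only if there exists $n$ such that $\ell_i(\sigma)=n$ for all but finitely many $i$. In this case $\ell(\sigma)=n$.
   Context: $S_\infty$ is the group of bijections $\mathbb N\to\mathbb N$ and $S_\infty^f$ the subgroup of those fixing all but finitely many elements. For $\sigma\in S_\infty^f$, the length $\ell(\sigma)$ is the number of inversions, i.e. pairs $i<j$ with $\sigma(i)>\sigma(j)$. For $\sigma\in S_\infty$ and $i\in\mathbb N$, $D_i(\sigma)=\{j\in\mathbb N: i<j,\ \sigma(i)>\sigma(j)\}$ and $\ell_i(\sigma)=\sum_{n=1}^i|D_n(\sigma)|$ (a finite number). -}

module Defs where

open import Data.Nat using (ℕ; zero; suc; _+_; _<_; _≤_; _⊔_; _<?_)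
open import Data.Nat.Properties using (_≟_)
open import Data.Bool using (Bool; true; false; _∧_)
open import Data.Product using (Σ; _×_; _,_; ∃-syntax)
open import Relation.Nullary using (does)
open import Relation.Binary.PropositionalEquality using (_≡_)
open import Function.Bundles using (_↔_; Inverse)

-- A permutation of ℕ (element of S_∞) is a bijection ℕ ↔ ℕ.
-- ℕ starts at 0 here (the paper's ℕ = {1,2,...}; shifting indices is harmless).

app : ℕ ↔ ℕ → ℕ → ℕ
app σ = Inverse.to σ

inv : ℕ ↔ ℕ → ℕ → ℕ
inv σ = Inverse.from σ

count : ℕ → (ℕ → Bool) → ℕ
count zero    p = 0
count (suc n) p = count n p + (if p n then 1 else 0)
  where
  if_then_else_ : Bool → ℕ → ℕ → ℕ
  if true  then a else b = a
  if false then a else b = b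

sumBelow : ℕ → (ℕ → ℕ) → ℕ
sumBelow zero    f = 0
sumBelow (suc n) f = sumBelow n f + f n

maxBelow : ℕ → (ℕ → ℕ) → ℕ
maxBelow zero    f = 0
maxBelow (suc n) f = maxBelow n f ⊔ f n

Finitary : ℕ ↔ ℕ → Set
Finitary σ = Σ ℕ λ N → ∀ i → N ≤ i → app σ i ≡ i

Eventually : (ℕ → Set) → Set
Eventually P = Σ ℕ λ M → ∀ i → M ≤ i → P i

inD : ℕ ↔ ℕ → ℕ → ℕ → Bool
inD σ i j = does (i <? j) ∧ does (app σ j <? app σ i)

-- Every j ∈ D_i(σ) has σ(j) < σ(i), i.e. j = σ⁻¹(k) for some k < σ(i);
-- hence D_i(σ) ⊆ [0, boundD σ i).  This only provides a finite window
-- in which the set D_i(σ) is counted literally.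
boundD : ℕ ↔ ℕ → ℕ → ℕ
boundD σ i = suc (maxBelow (app σ i) (inv σ))

cardD : ℕ ↔ ℕ → ℕ → ℕ
cardD σ i = count (boundD σ i) (inD σ i)

-- ℓ_i(σ) = Σ_{n ≤ i} |D_n(σ)|   (0-based version of Σ_{n=1}^i)
ℓᵢ : ℕ ↔ ℕ → ℕ → ℕ
ℓᵢ σ i = sumBelow (suc i) (cardD σ)

invBelow : ℕ ↔ ℕ → ℕ → ℕ
invBelow σ N = sumBelow N λ i → count N (inD σ i)

-- If σ fixes every i ≥ N,
-- then σ maps [0,N) onto itself and every inversion (i,j) has j < N, so
-- counting pairs inside [0,N) counts all inversions.
len : (σ : ℕ ↔ ℕ) → Finitary σ → ℕ
len σ (N , _) = invBelow σ N

{-# OPTIONS --safe #-}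
-- If σ fixes every i ≥ N, no inversion starts at or beyond N and every inversion lies
-- inside [0, N)², so ℓᵢ σ stabilises at ℓ(σ) from i = N - 1 on.  Conversely, if ℓᵢ σ
-- stabilises then D_i(σ) is eventually empty, i.e. σ is increasing on a tail [K, ∞).
-- On that tail σ(i) ≤ i, because σ⁻¹ maps [0, σ(i)] injectively into [0, i]; and
-- σ(i) ≥ i as soon as σ(i) exceeds σ([0, K)), because then σ maps [0, i] injectively
-- into [0, σ(i)].
module Submission where

open import Defs
open import Data.Nat using (ℕ; zero; suc; _+_; _<_; _≤_; _≤′_; ≤′-step; ≤′-refl; _⊔_; z≤n; s≤s; s≤s⁻¹)
open import Data.Nat.Properties
open import Data.Fin using (Fin; toℕ; fromℕ<)
open import Data.Fin.Properties using (toℕ<n; toℕ-fromℕ<; toℕ-injective; injective⇒≤)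
open import Data.Product using (Σ; _×_; _,_)
open import Data.Sum using (inj₁; inj₂)
open import Function using (_∘_)
open import Function.Bundles using (_↔_; _⇔_; Inverse; Injection; mk⇔)
open import Function.Properties.Inverse using (↔⇒↣; ↔-sym)
open import Relation.Nullary using (¬_; yes; no; does; contradiction)
open import Relation.Nullary.Decidable using (_×-dec_)
open import Level using (0ℓ)
open import Relation.Unary using (Pred; Decidable)
open import Relation.Binary.PropositionalEquality
open ≡-Reasoning

private
  variable
    m n i j k K M N W : ℕ

sumBelow-cong : ∀ {f g} → (∀ {k} → k < n → f k ≡ g k) → sumBelow n f ≡ sumBelow n g
sumBelow-cong {zero}  f≗g = refl
sumBelow-cong {suc n} f≗g = cong₂ _+_ (sumBelow-cong (f≗g ∘ m<n⇒m<1+n)) (f≗g ≤-refl)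

sumBelow-vanishing-tail : ∀ f → m ≤ n → (∀ {k} → m ≤ k → k < n → f k ≡ 0) →
                          sumBelow n f ≡ sumBelow m f
sumBelow-vanishing-tail {m} f = go ∘ ≤⇒≤′
  where
  go : m ≤′ n → (∀ {k} → m ≤ k → k < n → f k ≡ 0) → sumBelow n f ≡ sumBelow m f
  go ≤′-refl              _   = refl
  go (≤′-step {n} m≤′n) f≡0 = begin
    sumBelow n f + f n ≡⟨ cong (sumBelow n f +_) (f≡0 (≤′⇒≤ m≤′n) ≤-refl) ⟩
    sumBelow n f + 0   ≡⟨ +-identityʳ _ ⟩
    sumBelow n f       ≡⟨ go m≤′n (λ m≤k → f≡0 m≤k ∘ m<n⇒m<1+n) ⟩
    sumBelow m f       ∎

stable-partial-sums⇒vanishing : ∀ f → (∀ {i} → M ≤ i → sumBelow (suc i) f ≡ n) →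
                                M < k → f k ≡ 0
stable-partial-sums⇒vanishing {n = n} {k = suc i} f stable (s≤s M≤i) =
  +-cancelˡ-≡ n _ _ (begin
    n + f (suc i)                  ≡⟨ cong (_+ f (suc i)) (stable M≤i) ⟨
    sumBelow (suc (suc i)) f       ≡⟨ stable (m≤n⇒m≤1+n M≤i) ⟩
    n                              ≡⟨ +-identityʳ n ⟨
    n + 0                          ∎)

≤maxBelow : ∀ f → k < n → f k ≤ maxBelow n f
≤maxBelow {k} {suc n} f k<1+n with m≤n⇒m<n∨m≡n (s≤s⁻¹ k<1+n)
... | inj₁ k<n  = ≤-trans (≤maxBelow f k<n) (m≤m⊔n _ _)
... | inj₂ refl = m≤n⊔m _ _

module _ {P : Pred ℕ 0ℓ} (P? : Decidable P) where

  count-vanishing-tail : m ≤ n → (∀ {j} → m ≤ j → j < n → ¬ P j) →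
                         count n (does ∘ P?) ≡ count m (does ∘ P?)
  count-vanishing-tail {m} = go ∘ ≤⇒≤′
    where
    go : m ≤′ n → (∀ {j} → m ≤ j → j < n → ¬ P j) → count n (does ∘ P?) ≡ count m (does ∘ P?)
    go ≤′-refl _ = refl
    go (≤′-step {n} m≤′n) ¬P with P? n
    ... | yes Pn = contradiction Pn (¬P (≤′⇒≤ m≤′n) ≤-refl)
    ... | no _   = trans (+-identityʳ _) (go m≤′n (λ m≤j → ¬P m≤j ∘ m<n⇒m<1+n))

  count≡0⇒¬ : count n (does ∘ P?) ≡ 0 → j < n → ¬ P j
  count≡0⇒¬ {suc n} count≡0 j<1+n with P? n | m≤n⇒m<n∨m≡n (s≤s⁻¹ j<1+n)
  ... | yes _  | _         = contradiction (m+n≡0⇒n≡0 (count n (does ∘ P?)) count≡0) λ ()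
  ... | no ¬Pn | inj₂ refl = ¬Pn
  ... | no _   | inj₁ j<n  = count≡0⇒¬ (trans (sym (+-identityʳ _)) count≡0) j<n

bounded-injection⇒≤ : ∀ {a b} (f : ℕ → ℕ) → (∀ {x y} → f x ≡ f y → x ≡ y) →
                      (∀ {j} → j ≤ a → f j ≤ b) → a ≤ b
bounded-injection⇒≤ {a} {b} f f-injective f≤b = s≤s⁻¹ (injective⇒≤ g-injective)
  where
  g : Fin (suc a) → Fin (suc b)
  g x = fromℕ< (s≤s (f≤b (s≤s⁻¹ (toℕ<n x))))

  g-injective : ∀ {x y} → g x ≡ g y → x ≡ y
  g-injective {x} {y} gx≡gy = toℕ-injective (f-injective (begin
    f (toℕ x)      ≡⟨ toℕ-fromℕ< _ ⟨
    toℕ (g x)      ≡⟨ cong toℕ gx≡gy ⟩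
    toℕ (g y)      ≡⟨ toℕ-fromℕ< _ ⟩
    f (toℕ y)      ∎))

module _ (σ : ℕ ↔ ℕ) where

  app-injective : ∀ {x y} → app σ x ≡ app σ y → x ≡ y
  app-injective = Injection.injective (↔⇒↣ σ)

  inv-injective : ∀ {x y} → inv σ x ≡ inv σ y → x ≡ y
  inv-injective = Injection.injective (↔⇒↣ (↔-sym σ))

  Inversion : ℕ → ℕ → Set
  Inversion i j = i < j × app σ j < app σ i

  -- `inD σ i` is definitionally `does ∘ inversion? i`.
  inversion? : ∀ i → Decidable (Inversion i)
  inversion? i j = (i <? j) ×-dec (app σ j <? app σ i)

  inversion⇒<boundD : Inversion i j → j < boundD σ i
  inversion⇒<boundD {i} {j} (_ , σj<σi) =
    s≤s (subst (_≤ maxBelow (app σ i) (inv σ)) (Inverse.strictlyInverseʳ σ j)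
               (≤maxBelow (inv σ) σj<σi))

  count-inD≡cardD : (∀ {j} → Inversion i j → j < W) → count W (inD σ i) ≡ cardD σ i
  count-inD≡cardD {i} {W} inversions<W = begin
    count W (inD σ i)        ≡⟨ count-vanishing-tail (inversion? i) (m≤m⊔n W B) (beyond inversions<W) ⟨
    count (W ⊔ B) (inD σ i)  ≡⟨ count-vanishing-tail (inversion? i) (m≤n⊔m W B) (beyond inversion⇒<boundD) ⟩
    cardD σ i                ∎
    where
    B = boundD σ i
    beyond : ∀ {L} → (∀ {j} → Inversion i j → j < L) → ∀ {j} → L ≤ j → j < W ⊔ B → ¬ Inversion i j
    beyond inversions<L L≤j _ inv = <⇒≱ (inversions<L inv) L≤j

  cardD≡0 : (∀ {j} → ¬ Inversion i j) → cardD σ i ≡ 0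
  cardD≡0 {i} noInversion = count-vanishing-tail (inversion? i) {n = boundD σ i} z≤n (λ _ _ → noInversion)

  cardD≡0⇒¬Inversion : cardD σ i ≡ 0 → ¬ Inversion i j
  cardD≡0⇒¬Inversion {i} cardD≡0 inv = count≡0⇒¬ (inversion? i) cardD≡0 (inversion⇒<boundD inv) inv

module FixedBeyond (σ : ℕ ↔ ℕ) (N : ℕ) (fixed : ∀ i → N ≤ i → app σ i ≡ i) where

  app-<N : i < N → app σ i < N
  app-<N {i} i<N with app σ i <? N
  ... | yes σi<N = σi<N
  ... | no σi≮N  = contradiction (app-injective σ (fixed (app σ i) (≮⇒≥ σi≮N)))
                                 (λ σi≡i → σi≮N (subst (_< N) (sym σi≡i) i<N))

  ¬Inversion-beyond : N ≤ i → ¬ Inversion σ i j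
  ¬Inversion-beyond {i} {j} N≤i (i<j , σj<σi) =
    <-asym i<j (subst₂ _<_ (fixed j (≤-trans N≤i (<⇒≤ i<j))) (fixed i N≤i) σj<σi)

  inversion⇒<N : Inversion σ i j → j < N
  inversion⇒<N {i} {j} inv@(_ , σj<σi) with j <? N | i <? N
  ... | yes j<N | _       = j<N
  ... | no j≮N  | yes i<N = contradiction (subst (_< app σ i) (fixed j (≮⇒≥ j≮N)) σj<σi)
                                          (≤⇒≯ (≤-trans (<⇒≤ (app-<N i<N)) (≮⇒≥ j≮N)))
  ... | no _    | no i≮N  = contradiction inv (¬Inversion-beyond (≮⇒≥ i≮N))

  ℓᵢ-stable : N ≤ suc i → ℓᵢ σ i ≡ sumBelow N (cardD σ)
  ℓᵢ-stable N≤1+i = sumBelow-vanishing-tail (cardD σ) N≤1+i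
                      (λ N≤k _ → cardD≡0 σ (¬Inversion-beyond N≤k))

  invBelow≡sumBelow-cardD : invBelow σ N ≡ sumBelow N (cardD σ)
  invBelow≡sumBelow-cardD = sumBelow-cong {N} (λ {i} _ → count-inD≡cardD σ {i} inversion⇒<N)

module IncreasingBeyond (σ : ℕ ↔ ℕ) (K : ℕ)
                        (increasing : ∀ {i j} → K ≤ i → i < j → app σ i < app σ j) where

  app≤id : K ≤ i → app σ i ≤ i
  app≤id {i} K≤i = bounded-injection⇒≤ (inv σ) (inv-injective σ) inv≤i
    where
    inv≤i : ∀ {v} → v ≤ app σ i → inv σ v ≤ i
    inv≤i {v} v≤σi with inv σ v ≤? i
    ... | yes σ⁻¹v≤i = σ⁻¹v≤i
    ... | no σ⁻¹v≰i  = contradiction (subst (app σ i <_) (Inverse.strictlyInverseˡ σ v) (increasing K≤i (≰⇒> σ⁻¹v≰i)))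
                                     (≤⇒≯ v≤σi)

  ≤K+app : K ≤ i → i ≤ K + app σ i
  ≤K+app = go ∘ ≤⇒≤′
    where
    go : K ≤′ i → i ≤ K + app σ i
    go ≤′-refl            = m≤m+n K _
    go (≤′-step {i} K≤′i) = ≤-trans (s≤s (go K≤′i))
      (subst (_≤ K + app σ (suc i)) (+-suc K _) (+-monoʳ-≤ K (increasing (≤′⇒≤ K≤′i) ≤-refl)))

  id≤app : K + maxBelow K (app σ) ≤ i → i ≤ app σ i
  id≤app {i} K+B≤i = bounded-injection⇒≤ (app σ) (app-injective σ) app≤σi
    where
    K≤i : K ≤ i
    K≤i = m+n≤o⇒m≤o K K+B≤i

    B≤σi : maxBelow K (app σ) ≤ app σ i
    B≤σi = +-cancelˡ-≤ K _ _ (≤-trans K+B≤i (≤K+app K≤i))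

    app≤σi : ∀ {j} → j ≤ i → app σ j ≤ app σ i
    app≤σi {j} j≤i with j <? K | m≤n⇒m<n∨m≡n j≤i
    ... | yes j<K | _         = ≤-trans (≤maxBelow (app σ) j<K) B≤σi
    ... | no _    | inj₂ refl = ≤-refl
    ... | no j≮K  | inj₁ j<i  = <⇒≤ (increasing (≮⇒≥ j≮K) j<i)

  finitary : Finitary σ
  finitary = K + maxBelow K (app σ) , λ i K+B≤i →
    ≤-antisym (app≤id (m+n≤o⇒m≤o K K+B≤i)) (id≤app K+B≤i)

stable-ℓᵢ⇒increasing : ∀ σ → (∀ {i} → M ≤ i → ℓᵢ σ i ≡ n) →
                       suc M ≤ i → i < j → app σ i < app σ j
stable-ℓᵢ⇒increasing {i = i} σ stable M<i i<j =
  ≤∧≢⇒< (≮⇒≥ (λ σj<σi → cardD≡0⇒¬Inversion σ cardDᵢ≡0 (i<j , σj<σi)))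
        (<⇒≢ i<j ∘ app-injective σ)
  where
  cardDᵢ≡0 : cardD σ i ≡ 0
  cardDᵢ≡0 = stable-partial-sums⇒vanishing (cardD σ) stable M<i

mainTheorem7 : (σ : ℕ ↔ ℕ) →
    (Finitary σ ⇔ Σ ℕ (λ n → Eventually (λ i → ℓᵢ σ i ≡ n)))
    × ((fin : Finitary σ) (n : ℕ) → Eventually (λ i → ℓᵢ σ i ≡ n) → len σ fin ≡ n)
mainTheorem7 σ = mk⇔ ℓᵢ-eventually-constant finitary , len≡limit
  where
  ℓᵢ-eventually-constant : Finitary σ → Σ ℕ (λ n → Eventually (λ i → ℓᵢ σ i ≡ n))
  ℓᵢ-eventually-constant (N , fixed) =
    sumBelow N (cardD σ) , N , λ i N≤i → FixedBeyond.ℓᵢ-stable σ N fixed (m≤n⇒m≤1+n N≤i)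

  finitary : Σ ℕ (λ n → Eventually (λ i → ℓᵢ σ i ≡ n)) → Finitary σ
  finitary (n , M , stable) =
    IncreasingBeyond.finitary σ (suc M) (stable-ℓᵢ⇒increasing σ (stable _))

  len≡limit : (fin : Finitary σ) (n : ℕ) → Eventually (λ i → ℓᵢ σ i ≡ n) → len σ fin ≡ n
  len≡limit (N , fixed) n (M , stable) = begin
    invBelow σ N          ≡⟨ FixedBeyond.invBelow≡sumBelow-cardD σ N fixed ⟩
    sumBelow N (cardD σ)  ≡⟨ FixedBeyond.ℓᵢ-stable σ N fixed (m≤n⇒m≤1+n (m≤m⊔n N M)) ⟨
    ℓᵢ σ (N ⊔ M)          ≡⟨ stable (N ⊔ M) (m≤n⊔m N M) ⟩
    n                     ∎
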